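{- Let $r\ge 3$. Every homomorphism from $\overline{Q}_r$ to $\overline{Q}_r$ is either the identity homomorphism or a constant homomorphism $\mathbb{1}_{\overline{q}}$ for some $\overline{q}\in\overline{Q}_r$.
   Context: $\overline{Q}_r$ is the $r$-partite hypergraph with vertex classes $Q^{(j)}=\{0,1\}$ (one copy for each $j\in[r]$, the classes treated as disjoint) and hyperedge set $\overline{Q}_r=\{(q^{(1)},\dots,q^{(r)})\in\{0,1\}^r: \text{exactly one } q^{(j)} \text{ equals } 1\}$. A homomorphism from $\overline{Q}_r$ to itself is a tuple $f=(f^{(1)},\dots,f^{(r)})$ of maps $f^{(j)}:Q^{(j)}\to Q^{(j)}$ such that $(q^{(1)},\dots,q^{(r)})\in\overline{Q}_r$ implies $(f^{(1)}(q^{(1)}),\dots,f^{(r)}(q^{(r)}))\in\overline{Q}_r$. The identity homomorphism has every $f^{(j)}$ the identity map; for $\overline{q}=(q^{(1)},\dots,q^{(r)})\in\overline{Q}_r$, the constant homomorphism $\mathbb{1}_{\overline{q}}$ has $f^{(j)}$ constantly equal to $q^{(j)}$, so it maps every hyperedge to $\overline{q}$. -}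

module Defs where

open import Data.Nat using (ℕ)
open import Data.Fin using (Fin)
open import Data.Bool using (Bool; true; false)
open import Data.Product using (Σ; _×_; ∃-syntax)
open import Relation.Binary.PropositionalEquality using (_≡_)

-- A vertex choice (q⁽¹⁾,…,q⁽ʳ⁾) with q⁽ʲ⁾ ∈ Q⁽ʲ⁾ = {0,1}; 0 = false, 1 = true.
Tuple : ℕ → Set
Tuple r = Fin r → Bool

-- Hyperedges of Q̄_r: exactly one coordinate equals 1.
InQbar : (r : ℕ) → Tuple r → Set
InQbar r q = ∃[ j ] (q j ≡ true × (∀ k → q k ≡ true → k ≡ j))

Maps : ℕ → Set
Maps r = Fin r → Bool → Bool

apply : {r : ℕ} → Maps r → Tuple r → Tuple r
apply f q j = f j (q j)

IsHom : (r : ℕ) → Maps r → Set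
IsHom r f = ∀ (q : Tuple r) → InQbar r q → InQbar r (apply f q)

IsIdentity : (r : ℕ) → Maps r → Set
IsIdentity r f = ∀ j b → f j b ≡ b

IsConstant : (r : ℕ) → Maps r → Tuple r → Set
IsConstant r f q = ∀ j b → f j b ≡ q j

-- Feed the unit hyperedges e_i into f.  If some f⁽ᵐ⁾ sends 0 to 1, then the
-- image of e_t for t ∉ {j, m} (this needs r ≥ 3) already has its 1 at m, so
-- f⁽ʲ⁾(0) = 0, and the image of e_j shows f⁽ʲ⁾(1) = 0; hence f is constant at
-- e_m.  If no f⁽ʲ⁾ moves 0, the single 1 in the image of e_j must sit at j,
-- so f⁽ʲ⁾(1) = 1 and f is the identity.
module Submission where

open import Defs
open import Data.Nat using (ℕ; _≥_; s≤s)
open import Data.Sum using (_⊎_; inj₁; inj₂)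
open import Data.Product using (_×_; ∃-syntax; _,_)
open import Data.Fin using (Fin; zero; punchIn; punchOut)
open import Data.Fin.Properties
  using (_≟_; any?; punchInᵢ≢i; punchIn-injective; punchIn-punchOut)
open import Data.Bool using (true; false)
open import Data.Bool.Properties using (¬-not) renaming (_≟_ to _≟ᵇ_)
open import Function using (_∘_)
open import Relation.Nullary using (yes; no; does)
open import Relation.Nullary.Decidable using (dec-true; dec-false)
open import Relation.Binary.PropositionalEquality

avoid-two : ∀ {r} → r ≥ 3 → (j k : Fin r) → ∃[ t ] (t ≢ j × t ≢ k)
avoid-two (s≤s (s≤s (s≤s _))) j k with k ≟ j
... | yes refl = punchIn j zero , punchInᵢ≢i j zero , punchInᵢ≢i j zero
... | no k≢j   = punchIn j (punchIn k′ zero) , punchInᵢ≢i j _ , misses-k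
  where
  k′ = punchOut (k≢j ∘ sym)

  misses-k : punchIn j (punchIn k′ zero) ≢ k
  misses-k eq = punchInᵢ≢i k′ zero
    (punchIn-injective j _ _ (trans eq (sym (punchIn-punchOut (k≢j ∘ sym)))))

InQbar-unique : ∀ {r} {q : Tuple r} → InQbar r q →
  ∀ {k l} → q k ≡ true → q l ≡ true → k ≡ l
InQbar-unique (_ , _ , only) qk ql = trans (only _ qk) (sym (only _ ql))

unit : ∀ {r} → Fin r → Tuple r
unit i k = does (i ≟ k)

unit-self : ∀ {r} (i : Fin r) → unit i i ≡ true
unit-self i = dec-true (i ≟ i) refl

unit-other : ∀ {r} {i k : Fin r} → i ≢ k → unit i k ≡ false
unit-other {i = i} {k} = dec-false (i ≟ k)

unit-true : ∀ {r} {i k : Fin r} → unit i k ≡ true → i ≡ k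
unit-true {i = i} {k} with i ≟ k
... | yes i≡k = λ _ → i≡k
... | no _    = λ ()

unit-InQbar : ∀ {r} (i : Fin r) → InQbar r (unit i)
unit-InQbar i = i , unit-self i , λ _ → sym ∘ unit-true

module _ {r : ℕ} {f : Maps r} (hom : IsHom r f) where

  image-unique : ∀ i {k l} →
    apply f (unit i) k ≡ true → apply f (unit i) l ≡ true → k ≡ l
  image-unique i = InQbar-unique (hom (unit i) (unit-InQbar i))

  image-at-self : ∀ i → apply f (unit i) i ≡ f i true
  image-at-self i = cong (f i) (unit-self i)

  image-at-other : ∀ {i k} → i ≢ k → apply f (unit i) k ≡ f k false
  image-at-other {k = k} i≢k = cong (f k) (unit-other i≢k)

  -- Splitting on j ≟ k also evaluates unit j k = does (j ≟ k) inside hit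
  -- (and, below, inside the goal IsConstant r f (unit m) j b).
  true-fixed : ∀ {j} → (∀ k → j ≢ k → f k false ≡ false) → f j true ≡ true
  true-fixed {j} false-fixed with hom (unit j) (unit-InQbar j)
  ... | k , hit , _ with j ≟ k
  ...   | yes refl = hit
  ...   | no j≢k   with () ← trans (sym (false-fixed k j≢k)) hit

  identity-if-false-fixed : (∀ j → f j false ≡ false) → IsIdentity r f
  identity-if-false-fixed false-fixed j false = false-fixed j
  identity-if-false-fixed false-fixed j true  = true-fixed (λ k _ → false-fixed k)

  module _ (r≥3 : r ≥ 3) {m : Fin r} (moved : f m false ≡ true) where

    false-fixed-off : ∀ {j} → m ≢ j → f j false ≡ false
    false-fixed-off {j} m≢j with avoid-two r≥3 j m
    ... | t , t≢j , t≢m = ¬-not λ hit → m≢j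
      (image-unique t (trans (image-at-other t≢m) moved)
                      (trans (image-at-other t≢j) hit))

    true-dropped-off : ∀ {j} → m ≢ j → f j true ≡ false
    true-dropped-off {j} m≢j = ¬-not λ hit → m≢j
      (image-unique j (trans (image-at-other (m≢j ∘ sym)) moved)
                      (trans (image-at-self j) hit))

    constant-if-false-moved : IsConstant r f (unit m)
    constant-if-false-moved j b with m ≟ j
    constant-if-false-moved j false | yes refl = moved
    constant-if-false-moved j true  | yes refl = true-fixed (λ _ → false-fixed-off)
    constant-if-false-moved j false | no m≢j   = false-fixed-off m≢j
    constant-if-false-moved j true  | no m≢j   = true-dropped-off m≢j

claim3p7 : (r : ℕ) → r ≥ 3 → (f : Maps r) → IsHom r f →
    IsIdentity r f ⊎ (∃[ q ] (InQbar r q × IsConstant r f q))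
claim3p7 r r≥3 f hom with any? (λ j → f j false ≟ᵇ true)
... | yes (m , moved) =
  inj₂ (unit m , unit-InQbar m , constant-if-false-moved hom r≥3 moved)
... | no none-moved   =
  inj₁ (identity-if-false-fixed hom λ j → ¬-not λ moved → none-moved (j , moved))
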